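{- The smallest number of vertices of a finite 6-regular simple graph $G$ which, for every $r \in \{1,2,\ldots,6\}$, has an independent exact $r$-cover, is $9240$.
   Context: Let $G$ be a $d$-regular simple graph. For $0 \le r \le d$, an independent exact $r$-cover of $G$ is a subset $S \subseteq V(G)$ such that no edge of $G$ has both endpoints in $S$, and every vertex of $V(G)\setminus S$ is adjacent to exactly $r$ vertices of $S$. -}

module Defs where

open import Data.Nat using (ℕ; _≤_; _<_)
open import Data.Bool using (Bool; true; false; if_then_else_; _∧_)
open import Data.Fin using (Fin)
open import Data.List using (List; map; allFin)
open import Data.Nat.ListAction using (sum)
open import Data.Product using (Σ; _×_)
open import Relation.Binary.PropositionalEquality using (_≡_)

record SimpleGraph (n : ℕ) : Set where
  field
    adj    : Fin n → Fin n → Bool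
    sym    : ∀ u v → adj u v ≡ adj v u
    irrefl : ∀ v → adj v v ≡ false
open SimpleGraph public

countFin : {n : ℕ} → (Fin n → Bool) → ℕ
countFin {n} p = sum (map (λ u → if p u then 1 else 0) (allFin n))

degree : {n : ℕ} → SimpleGraph n → Fin n → ℕ
degree G v = countFin (adj G v)

IsRegular : {n : ℕ} → ℕ → SimpleGraph n → Set
IsRegular d G = ∀ v → degree G v ≡ d

VSet : ℕ → Set
VSet n = Fin n → Bool

IsIndependent : {n : ℕ} → SimpleGraph n → VSet n → Set
IsIndependent G S = ∀ u v → S u ≡ true → S v ≡ true → adj G u v ≡ false

IsIndependentExactCover : {n : ℕ} → SimpleGraph n → ℕ → VSet n → Set
IsIndependentExactCover G r S =
  IsIndependent G S ×
  (∀ v → S v ≡ false → countFin (λ u → adj G v u ∧ S u) ≡ r)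

HasAllCovers6 : ℕ → Set
HasAllCovers6 n =
  Σ (SimpleGraph n) λ G →
    IsRegular 6 G ×
    (∀ r → 1 ≤ r → r ≤ 6 → Σ (VSet n) λ S → IsIndependentExactCover G r S)

{-# OPTIONS --safe #-}

-- If P is an independent exact 6-cover of a 6-regular graph, every vertex outside P has all its
-- neighbours in P, so the graph is bipartite with sides P and its complement, which have the same
-- size m. Double counting the edges between an exact r-cover S (r < 6) and each side forces
-- |S ∩ P| = |S ∖ P| and then (6 + r)·|S ∩ P| = r·m. For r = 1, …, 5 this makes 7, 4, 3, 5 and 11
-- divide m, so 4620 ∣ m and the graph has 2m ≥ 9240 vertices.
--
-- Conversely, six involutions of a finite set form a 6-regular multigraph (the i-th neighbour of x
-- is its image under the i-th involution), and exact covers of a factor pull back to the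
-- componentwise product of two such families. For each r there is a small factor on p + q points,
-- made of partial matchings of K_{p,q}, whose p-side is an exact r-cover. The product of the six
-- factors has 2 · 7 · 4 · 3 · 5 · 11 = 9240 points; it has no fixed points and distinct neighbours
-- because one factor has each property, so it is a simple 6-regular graph with all six covers.

module Submission where

open import Data.Bool using (Bool; true; false; if_then_else_; _∧_; _∨_; not)
open import Data.Bool.Properties
  using (∧-identityʳ; ∧-comm; ∧-idem; ∧-zeroʳ; ∧-distribʳ-∨; not-involutive)
open import Data.Fin using (Fin; zero; suc; toℕ; combine; remQuot)
open import Data.Fin.Properties
  using (_≟_; any?; all?; 0≢1+n; suc-injective; remQuot-combine; combine-remQuot)
open import Data.List using (map; tabulate; allFin)
open import Data.List.Properties using (map-cong; map-tabulate)
open import Data.Nat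
  using (ℕ; zero; suc; _+_; _*_; _∸_; _%_; _<ᵇ_; _≤_; _<_; _≤?_; _<?_; z≤n; s≤s; NonZero; ≢-nonZero)
import Data.Nat as ℕ
open import Data.Nat.Coprimality using (Coprime; coprime?; coprime-divisor)
open import Data.Nat.Divisibility using (_∣_; divides; *-cancelʳ-∣; ∣⇒≤)
open import Data.Nat.DivMod using (_mod_)
open import Data.Nat.LCM using (lcm-least)
open import Data.Nat.ListAction using (sum)
open import Data.Nat.Properties
  using ( +-comm; *-comm; *-assoc; *-distribʳ-+; *-distribˡ-+; +-identityʳ; *-zeroʳ; *-identityʳ
        ; +-cancelˡ-≡; *-cancelʳ-≡; *-cancelˡ-≡; m+n≡0⇒n≡0; ≤-refl; <⇒≢; <⇒≤; <⇒≱; +-mono-≤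
        ; +-*-semiring )
open import Algebra.Properties.Semiring.Sum +-*-semiring
  using (sum-syntax; sum-cong-≗; sum-replicate-zero; ∑-distrib-+; ∑-comm; *-distribˡ-sum)
open import Data.Nat.Tactic.RingSolver using (solve-∀)
open import Data.Product using (_×_; _,_; proj₁; proj₂; ∃-syntax; uncurry)
import Data.Product as Product
open import Function using (_∘_; mk⇔)
open import Function.Definitions using (Injective)
open import Relation.Binary.PropositionalEquality
open import Relation.Nullary using (¬_; contradiction)
open import Relation.Nullary.Decidable
  using (Dec; does; yes; no; ¬?; _→-dec_; map′; dec-false; does-⇔; True; toWitness; from-yes)

open import Defs renaming (sym to adj-sym)

indicator : Bool → ℕ
indicator b = if b then 1 else 0

private
  variable
    n : ℕ

countFin≡∑ : (p : Fin n → Bool) → countFin p ≡ ∑[ u < n ] indicator (p u)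
countFin≡∑ {zero}  p = refl
countFin≡∑ {suc n} p = cong (indicator (p zero) +_) (begin
  sum (map f (tabulate suc))         ≡⟨ cong sum (map-tabulate suc f) ⟩
  sum (tabulate (f ∘ suc))           ≡⟨ cong sum (map-tabulate (λ u → u) (f ∘ suc)) ⟨
  countFin (p ∘ suc)                 ≡⟨ countFin≡∑ (p ∘ suc) ⟩
  ∑[ u < n ] indicator (p (suc u))   ∎)
  where
  open ≡-Reasoning
  f : Fin (suc n) → ℕ
  f u = indicator (p u)

countFin-suc : (p : Fin (suc n) → Bool) → countFin p ≡ indicator (p zero) + countFin (p ∘ suc)
countFin-suc p = trans (countFin≡∑ p) (cong (indicator (p zero) +_) (sym (countFin≡∑ (p ∘ suc))))

countFin-cong : {p q : Fin n → Bool} → (∀ u → p u ≡ q u) → countFin p ≡ countFin q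
countFin-cong {n} p≗q = cong sum (map-cong (cong indicator ∘ p≗q) (allFin n))

countFin-false : countFin {n} (λ _ → false) ≡ 0
countFin-false {n} = trans (countFin≡∑ {n} (λ _ → false)) (sum-replicate-zero n)

countFin-true : countFin {n} (λ _ → true) ≡ n
countFin-true {n} = trans (countFin≡∑ {n} (λ _ → true)) (∑-ones n)
  where
  ∑-ones : ∀ n → ∑[ u < n ] 1 ≡ n
  ∑-ones zero    = refl
  ∑-ones (suc n) = cong suc (∑-ones n)

countFin≡0⇒false : (p : Fin n → Bool) → countFin p ≡ 0 → ∀ u → p u ≡ false
countFin≡0⇒false p #p≡0 = ∑≡0⇒false p (trans (sym (countFin≡∑ p)) #p≡0)
  where
  ∑≡0⇒false : ∀ {n} (p : Fin n → Bool) → ∑[ u < n ] indicator (p u) ≡ 0 → ∀ u → p u ≡ false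
  ∑≡0⇒false p ∑≡0 zero with p zero
  ... | false = refl
  ∑≡0⇒false p ∑≡0 (suc u) = ∑≡0⇒false (p ∘ suc) (m+n≡0⇒n≡0 (indicator (p zero)) ∑≡0) u

countFin-split : (p q : Fin n → Bool) →
                 countFin p ≡ countFin (λ u → p u ∧ q u) + countFin (λ u → p u ∧ not (q u))
countFin-split {n} p q = begin
  countFin p                                         ≡⟨ countFin≡∑ p ⟩
  ∑[ u < n ] indicator (p u)                         ≡⟨ sum-cong-≗ (λ u → split (p u) (q u)) ⟩
  ∑[ u < n ] (indicator (p∧q u) + indicator (p∧¬q u))
    ≡⟨ ∑-distrib-+ (indicator ∘ p∧q) (indicator ∘ p∧¬q) ⟩
  ∑[ u < n ] indicator (p∧q u) + ∑[ u < n ] indicator (p∧¬q u)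
    ≡⟨ cong₂ _+_ (countFin≡∑ p∧q) (countFin≡∑ p∧¬q) ⟨
  countFin p∧q + countFin p∧¬q                       ∎
  where
  open ≡-Reasoning
  p∧q p∧¬q : Fin n → Bool
  p∧q  u = p u ∧ q u
  p∧¬q u = p u ∧ not (q u)
  split : ∀ b c → indicator b ≡ indicator (b ∧ c) + indicator (b ∧ not c)
  split false c     = refl
  split true  false = refl
  split true  true  = refl

countFin-∨ : (p q : Fin n → Bool) → (∀ u → p u ∧ q u ≡ false) →
             countFin (λ u → p u ∨ q u) ≡ countFin p + countFin q
countFin-∨ {n} p q disjoint = begin
  countFin (λ u → p u ∨ q u)
    ≡⟨ countFin≡∑ (λ u → p u ∨ q u) ⟩
  ∑[ u < n ] indicator (p u ∨ q u)
    ≡⟨ sum-cong-≗ (λ u → split (p u) (q u) (disjoint u)) ⟩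
  ∑[ u < n ] (indicator (p u) + indicator (q u))
    ≡⟨ ∑-distrib-+ (indicator ∘ p) (indicator ∘ q) ⟩
  ∑[ u < n ] indicator (p u) + ∑[ u < n ] indicator (q u)
    ≡⟨ cong₂ _+_ (countFin≡∑ p) (countFin≡∑ q) ⟨
  countFin p + countFin q
    ∎
  where
  open ≡-Reasoning
  split : ∀ b c → b ∧ c ≡ false → indicator (b ∨ c) ≡ indicator b + indicator c
  split false c     _ = refl
  split true  false _ = refl

countFin-≟ : (x : Fin n) (S : Fin n → Bool) → countFin (λ u → does (u ≟ x) ∧ S u) ≡ indicator (S x)
countFin-≟ x S = trans (countFin≡∑ (λ u → does (u ≟ x) ∧ S u)) (∑-≟ x S)
  where
  ∑-≟ : ∀ {n} (x : Fin n) (S : Fin n → Bool) → ∑[ u < n ] indicator (does (u ≟ x) ∧ S u) ≡ indicator (S x)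
  ∑-≟ {suc n} zero    S = trans (cong (indicator (S zero) +_) (sum-replicate-zero n)) (+-identityʳ _)
  ∑-≟ {suc n} (suc x) S = ∑-≟ x (S ∘ suc)

countFin-image : ∀ {k} (t : Fin k → Fin n) → Injective _≡_ _≡_ t → (S : Fin n → Bool) →
                 countFin (λ u → does (any? λ i → u ≟ t i) ∧ S u) ≡ countFin (λ i → S (t i))
countFin-image {n = n} {k = zero} t t-inj S = countFin-false {n}
countFin-image {n = n} {k = suc k} t t-inj S = begin
  countFin (λ u → (is-t₀ u ∨ rest u) ∧ S u)
    ≡⟨ countFin-cong (λ u → ∧-distribʳ-∨ (S u) (is-t₀ u) (rest u)) ⟩
  countFin (λ u → (is-t₀ u ∧ S u) ∨ (rest u ∧ S u))
    ≡⟨ countFin-∨ _ _ disjoint ⟩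
  countFin (λ u → is-t₀ u ∧ S u) + countFin (λ u → rest u ∧ S u)
    ≡⟨ cong₂ _+_ (countFin-≟ (t zero) S) (countFin-image (t ∘ suc) (suc-injective ∘ t-inj) S) ⟩
  indicator (S (t zero)) + countFin (λ i → S (t (suc i)))
    ≡⟨ countFin-suc (S ∘ t) ⟨
  countFin (λ i → S (t i))
    ∎
  where
  open ≡-Reasoning
  is-t₀ rest : Fin n → Bool
  is-t₀ u = does (u ≟ t zero)
  rest  u = does (any? λ i → u ≟ t (suc i))
  disjoint : ∀ u → (is-t₀ u ∧ S u) ∧ (rest u ∧ S u) ≡ false
  disjoint u with u ≟ t zero
  ... | no _ = refl
  ... | yes u≡t₀ rewrite dec-false (any? λ i → u ≟ t (suc i))
                           (λ (i , u≡tᵢ) → 0≢1+n (t-inj (trans (sym u≡t₀) u≡tᵢ))) = ∧-zeroʳ (S u)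

degreeIn : SimpleGraph n → Fin n → VSet n → ℕ
degreeIn G v S = countFin (λ u → adj G v u ∧ S u)

module _ {n r : ℕ} (G : SimpleGraph n) {S : VSet n} where

  exactCover⇒degreeIn : IsIndependentExactCover G r S → ∀ v → degreeIn G v S ≡ (if S v then 0 else r)
  exactCover⇒degreeIn (independent , covered) v with S v in Sv
  ... | true  = trans (countFin-cong no-neighbour) (countFin-false {n})
    where
    no-neighbour : ∀ u → adj G v u ∧ S u ≡ false
    no-neighbour u with S u in Su
    ... | true  = trans (∧-identityʳ (adj G v u)) (independent v u Sv Su)
    ... | false = ∧-zeroʳ (adj G v u)
  ... | false = covered v Sv

  degreeIn⇒exactCover : (∀ v → degreeIn G v S ≡ (if S v then 0 else r)) → IsIndependentExactCover G r S
  degreeIn⇒exactCover degrees = independent , covered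
    where
    independent : IsIndependent G S
    independent u v Su Sv = begin
      adj G u v           ≡⟨ ∧-identityʳ (adj G u v) ⟨
      adj G u v ∧ true    ≡⟨ cong (adj G u v ∧_) Sv ⟨
      adj G u v ∧ S v     ≡⟨ countFin≡0⇒false _ (trans (degrees u) (cong (if_then 0 else r) Su)) v ⟩
      false               ∎
      where open ≡-Reasoning
    covered : ∀ v → S v ≡ false → degreeIn G v S ≡ r
    covered v Sv = trans (degrees v) (cong (if_then 0 else r) Sv)

module _ {n : ℕ} (G : SimpleGraph n) where

  edges : VSet n → VSet n → ℕ
  edges X Y = ∑[ v < n ] ∑[ u < n ] indicator (X v ∧ adj G v u ∧ Y u)

  edges-sym : ∀ X Y → edges X Y ≡ edges Y X
  edges-sym X Y = trans (∑-comm (λ v u → indicator (X v ∧ adj G v u ∧ Y u)))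
                        (sum-cong-≗ λ u → sum-cong-≗ λ v → cong indicator (flip v u))
    where
    flip : ∀ v u → X v ∧ adj G v u ∧ Y u ≡ Y u ∧ adj G u v ∧ X v
    flip v u rewrite adj-sym G v u with X v | Y u
    ... | true  | true  = refl
    ... | true  | false = ∧-zeroʳ (adj G u v)
    ... | false | true  = sym (∧-zeroʳ (adj G u v))
    ... | false | false = refl

  edges-from : ∀ X {l Y} → (∀ v → degreeIn G v Y ≡ (if Y v then 0 else l)) →
               edges X Y ≡ l * countFin (λ v → X v ∧ not (Y v))
  edges-from X {l} {Y} Y-degrees = begin
    edges X Y                                     ≡⟨ sum-cong-≗ row ⟩
    ∑[ v < n ] (l * indicator (X v ∧ not (Y v)))  ≡⟨ *-distribˡ-sum l (λ v → indicator (X v ∧ not (Y v))) ⟨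
    l * ∑[ v < n ] indicator (X v ∧ not (Y v))    ≡⟨ cong (l *_) (countFin≡∑ (λ v → X v ∧ not (Y v))) ⟨
    l * countFin (λ v → X v ∧ not (Y v))          ∎
    where
    open ≡-Reasoning
    row : ∀ v → ∑[ u < n ] indicator (X v ∧ adj G v u ∧ Y u) ≡ l * indicator (X v ∧ not (Y v))
    row v with X v
    ... | false = trans (sum-replicate-zero n) (sym (*-zeroʳ l))
    ... | true  = trans (sym (countFin≡∑ (λ u → adj G v u ∧ Y u))) (trans (Y-degrees v) (scale (Y v)))
      where
      scale : ∀ b → (if b then 0 else l) ≡ l * indicator (not b)
      scale true  = sym (*-zeroʳ l)
      scale false = sym (*-identityʳ l)

  double-count : ∀ {k l X Y} →
                 (∀ v → degreeIn G v X ≡ (if X v then 0 else k)) →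
                 (∀ v → degreeIn G v Y ≡ (if Y v then 0 else l)) →
                 l * countFin (λ v → X v ∧ not (Y v)) ≡ k * countFin (λ v → Y v ∧ not (X v))
  double-count {X = X} {Y} X-degrees Y-degrees =
    trans (sym (edges-from X Y-degrees)) (trans (edges-sym X Y) (edges-from Y X-degrees))

cross-cancel : ∀ {r d} a b → r ≢ d → r * a + d * b ≡ r * b + d * a → a ≡ b
cross-cancel zero    zero    r≢d eq = refl
cross-cancel {r} {d} zero (suc b) r≢d eq = contradiction (*-cancelʳ-≡ r d (suc b) (begin
  r * suc b              ≡⟨ +-identityʳ (r * suc b) ⟨
  r * suc b + 0          ≡⟨ cong (r * suc b +_) (*-zeroʳ d) ⟨
  r * suc b + d * 0      ≡⟨ eq ⟨
  r * 0 + d * suc b      ≡⟨ cong (_+ d * suc b) (*-zeroʳ r) ⟩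
  d * suc b              ∎)) r≢d
  where open ≡-Reasoning
cross-cancel (suc a) zero    r≢d eq = sym (cross-cancel zero (suc a) r≢d (sym eq))
cross-cancel {r} {d} (suc a) (suc b) r≢d eq =
  cong suc (cross-cancel a b r≢d (+-cancelˡ-≡ (r + d) _ _
    (trans (sym (shift r d a b)) (trans eq (shift r d b a)))))
  where
  shift : ∀ r d a b → r * suc a + d * suc b ≡ (r + d) + (r * a + d * b)
  shift = solve-∀

cover-proportion : ∀ {r d a a′ b b′} → r ≢ d →
                   r * a′ ≡ d * b → r * b′ ≡ d * a → a + a′ ≡ b + b′ →
                   (d + r) * a ≡ r * (a + a′)
cover-proportion {r} {d} {a} {a′} {b} {b′} r≢d ra′≡db rb′≡da sizes = begin
  (d + r) * a      ≡⟨ *-distribʳ-+ a d r ⟩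
  d * a + r * a    ≡⟨ cong (λ x → d * x + r * a) a≡b ⟩
  d * b + r * a    ≡⟨ cong (_+ r * a) ra′≡db ⟨
  r * a′ + r * a   ≡⟨ +-comm (r * a′) (r * a) ⟩
  r * a + r * a′   ≡⟨ *-distribˡ-+ r a a′ ⟨
  r * (a + a′)     ∎
  where
  open ≡-Reasoning
  a≡b : a ≡ b
  a≡b = cross-cancel a b r≢d (begin
    r * a + d * b     ≡⟨ cong (r * a +_) ra′≡db ⟨
    r * a + r * a′    ≡⟨ *-distribˡ-+ r a a′ ⟨
    r * (a + a′)      ≡⟨ cong (r *_) sizes ⟩
    r * (b + b′)      ≡⟨ *-distribˡ-+ r b b′ ⟩
    r * b + r * b′    ≡⟨ cong (r * b +_) rb′≡da ⟩
    r * b + d * a     ∎)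

module Bipartition {n d : ℕ} .{{_ : NonZero d}} (G : SimpleGraph n) (regular : IsRegular d G)
                   {P : VSet n} (P-cover : IsIndependentExactCover G d P) where

  P-degrees : ∀ v → degreeIn G v P ≡ (if P v then 0 else d)
  P-degrees = exactCover⇒degreeIn G P-cover

  complement-degrees : ∀ v → degreeIn G v (not ∘ P) ≡ (if not (P v) then 0 else d)
  complement-degrees v =
    other-side (P v) (P-degrees v) (trans (sym (countFin-split (adj G v) P)) (regular v))
    where
    other-side : ∀ b {x y} → x ≡ (if b then 0 else d) → x + y ≡ d → y ≡ (if not b then 0 else d)
    other-side true  refl y≡d   = y≡d
    other-side false refl d+y≡d = +-cancelˡ-≡ d _ 0 (trans d+y≡d (sym (+-identityʳ d)))

  complement-size : countFin (not ∘ P) ≡ countFin P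
  complement-size = *-cancelˡ-≡ _ _ d (begin
    d * countFin (not ∘ P)                          ≡⟨ cong (d *_) (countFin-cong λ v → ∧-idem (not (P v))) ⟨
    d * countFin (λ v → not (P v) ∧ not (P v))      ≡⟨ double-count G P-degrees complement-degrees ⟨
    d * countFin (λ v → P v ∧ not (not (P v)))      ≡⟨ cong (d *_) (countFin-cong λ v → P∧¬¬P (P v)) ⟩
    d * countFin P                                  ∎)
    where
    open ≡-Reasoning
    P∧¬¬P : ∀ b → b ∧ not (not b) ≡ b
    P∧¬¬P true  = refl
    P∧¬¬P false = refl

  vertex-count : n ≡ countFin P + countFin P
  vertex-count = begin
    n                                      ≡⟨ countFin-true {n} ⟨
    countFin {n} (λ _ → true)              ≡⟨ countFin-split (λ _ → true) P ⟩
    countFin P + countFin (not ∘ P)        ≡⟨ cong (countFin P +_) complement-size ⟩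
    countFin P + countFin P                ∎
    where open ≡-Reasoning

  cover-size : ∀ {r S} → r ≢ d → IsIndependentExactCover G r S →
               (d + r) * countFin (λ v → P v ∧ S v) ≡ r * countFin P
  cover-size {r} {S} r≢d S-cover = begin
    (d + r) * countFin (λ v → P v ∧ S v)
      ≡⟨ cover-proportion r≢d edges-P edges-¬P sizes ⟩
    r * (countFin (λ v → P v ∧ S v) + countFin (λ v → P v ∧ not (S v)))
      ≡⟨ cong (r *_) (countFin-split P S) ⟨
    r * countFin P ∎
    where
    open ≡-Reasoning
    S-degrees : ∀ v → degreeIn G v S ≡ (if S v then 0 else r)
    S-degrees = exactCover⇒degreeIn G S-cover

    edges-P : r * countFin (λ v → P v ∧ not (S v)) ≡ d * countFin (λ v → not (P v) ∧ S v)
    edges-P = trans (double-count G P-degrees S-degrees)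
                    (cong (d *_) (countFin-cong λ v → ∧-comm (S v) (not (P v))))

    edges-¬P : r * countFin (λ v → not (P v) ∧ not (S v)) ≡ d * countFin (λ v → P v ∧ S v)
    edges-¬P = trans (double-count G complement-degrees S-degrees)
                     (cong (d *_) (countFin-cong λ v →
                       trans (cong (S v ∧_) (not-involutive (P v))) (∧-comm (S v) (P v))))

    sizes : countFin (λ v → P v ∧ S v) + countFin (λ v → P v ∧ not (S v)) ≡
            countFin (λ v → not (P v) ∧ S v) + countFin (λ v → not (P v) ∧ not (S v))
    sizes = trans (sym (countFin-split P S)) (trans (sym complement-size) (countFin-split (not ∘ P) S))

∣-of-proportion : ∀ q s g {m} .{{_ : NonZero g}} → Coprime q s → ∃[ a ] q * g * a ≡ s * g * m → q ∣ m
∣-of-proportion q s g {m} q⊥s (a , eq) = coprime-divisor q⊥s (*-cancelʳ-∣ g (divides a (begin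
  s * m * g      ≡⟨ *-assoc s m g ⟩
  s * (m * g)    ≡⟨ cong (s *_) (*-comm m g) ⟩
  s * (g * m)    ≡⟨ *-assoc s g m ⟨
  s * g * m      ≡⟨ eq ⟨
  q * g * a      ≡⟨ *-comm (q * g) a ⟩
  a * (q * g)    ∎)))
  where open ≡-Reasoning

hasAllCovers6⇒9240≤ : ∀ {n} → 1 ≤ n → HasAllCovers6 n → 9240 ≤ n
hasAllCovers6⇒9240≤ {n} 1≤n (G , regular , cover) =
  subst (9240 ≤_) (sym vertex-count) (+-mono-≤ 4620≤m 4620≤m)
  where
  P : VSet n
  P = proj₁ (cover 6 (s≤s z≤n) ≤-refl)
  open Bipartition G regular (proj₂ (cover 6 (s≤s z≤n) ≤-refl))
  m : ℕ
  m = countFin P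

  proportional : ∀ r {1≤r : True (1 ≤? r)} {r<6 : True (r <? 6)} → ∃[ a ] (6 + r) * a ≡ r * m
  proportional r {1≤r} {r<6} = countFin (λ v → P v ∧ S v) , cover-size (<⇒≢ r<6′) S-cover
    where
    r<6′ : r < 6
    r<6′ = toWitness r<6
    S : VSet n
    S = proj₁ (cover r (toWitness 1≤r) (<⇒≤ r<6′))
    S-cover : IsIndependentExactCover G r S
    S-cover = proj₂ (cover r (toWitness 1≤r) (<⇒≤ r<6′))

  -- the arguments q s g factor 6 + r = q · g and r = s · g
  4620∣m : 4620 ∣ m
  4620∣m = lcm-least (lcm-least (lcm-least (lcm-least
    (∣-of-proportion 7  1 1 (from-yes (coprime? 7  1)) (proportional 1))
    (∣-of-proportion 4  1 2 (from-yes (coprime? 4  1)) (proportional 2)))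
    (∣-of-proportion 3  1 3 (from-yes (coprime? 3  1)) (proportional 3)))
    (∣-of-proportion 5  2 2 (from-yes (coprime? 5  2)) (proportional 4)))
    (∣-of-proportion 11 5 1 (from-yes (coprime? 11 5)) (proportional 5))

  m≢0 : m ≢ 0
  m≢0 m≡0 = contradiction (subst (1 ≤_) (trans vertex-count (cong (λ k → k + k) m≡0)) 1≤n) λ ()

  4620≤m : 4620 ≤ m
  4620≤m = ∣⇒≤ {{≢-nonZero m≢0}} 4620∣m

-- A fixed point of act i is a loop. Without η the product σ ⊗ τ stays rigid, so its factors can
-- be inferred by unification.
record Involutions (d m : ℕ) : Set where
  no-eta-equality
  field
    act            : Fin d → Fin m → Fin m
    act-involutive : ∀ i x → act i (act i x) ≡ x
open Involutions

module _ {d m : ℕ} (σ : Involutions d m) where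

  record IsFixedPointFree : Set where
    field fixedPointFree : ∀ i x → act σ i x ≢ x

  record HasDistinctNeighbours : Set where
    field distinctNeighbours : ∀ x → Injective _≡_ _≡_ (λ i → act σ i x)

  record IsExactCover (r : ℕ) (X : Fin m → Bool) : Set where
    field counts : ∀ x → countFin (λ i → X (act σ i x)) ≡ (if X x then 0 else r)

  isFixedPointFree? : Dec IsFixedPointFree
  isFixedPointFree? = map′ (λ fpf → record { fixedPointFree = fpf }) IsFixedPointFree.fixedPointFree
    (all? λ i → all? λ x → ¬? (act σ i x ≟ x))

  hasDistinctNeighbours? : Dec HasDistinctNeighbours
  hasDistinctNeighbours? = map′ (λ inj → record { distinctNeighbours = λ x {i} {j} → inj x i j })
                                (λ σ-distinct x i j → HasDistinctNeighbours.distinctNeighbours σ-distinct x)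
    (all? λ x → all? λ i → all? λ j → (act σ i x ≟ act σ j x) →-dec (i ≟ j))

  isExactCover? : ∀ r X → Dec (IsExactCover r X)
  isExactCover? r X = map′ (λ counts → record { counts = counts }) IsExactCover.counts
    (all? λ x → countFin (λ i → X (act σ i x)) ℕ.≟ (if X x then 0 else r))

  module InvolutionGraph (σ-fpf : IsFixedPointFree) (σ-distinct : HasDistinctNeighbours) where
    open IsFixedPointFree σ-fpf
    open HasDistinctNeighbours σ-distinct

    graph : SimpleGraph m
    graph = record
      { adj    = λ v u → does (any? λ i → u ≟ act σ i v)
      ; sym    = λ v u → does-⇔ (mk⇔ swap swap) (any? _) (any? _)
      ; irrefl = λ v → dec-false (any? _) λ (i , v≡σᵢv) → fixedPointFree i v (sym v≡σᵢv)
      }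
      where
      swap : ∀ {v u} → ∃[ i ] u ≡ act σ i v → ∃[ i ] v ≡ act σ i u
      swap {v} (i , refl) = i , sym (act-involutive σ i v)

    degreeIn-graph : ∀ v S → degreeIn graph v S ≡ countFin (λ i → S (act σ i v))
    degreeIn-graph v = countFin-image (λ i → act σ i v) (distinctNeighbours v)

    regular : IsRegular d graph
    regular v = begin
      degree graph v                       ≡⟨ countFin-cong (λ u → ∧-identityʳ (adj graph v u)) ⟨
      degreeIn graph v (λ _ → true)        ≡⟨ degreeIn-graph v (λ _ → true) ⟩
      countFin {d} (λ _ → true)            ≡⟨ countFin-true ⟩
      d                                    ∎
      where open ≡-Reasoning

    exactCover : ∀ {r X} → IsExactCover r X → IsIndependentExactCover graph r X
    exactCover X-cover =
      degreeIn⇒exactCover graph λ v → trans (degreeIn-graph v _) (IsExactCover.counts X-cover v)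

hasAllCovers6 : ∀ {m} (σ : Involutions 6 m) → IsFixedPointFree σ → HasDistinctNeighbours σ →
                (∀ r → 1 ≤ r → r ≤ 6 → ∃[ X ] IsExactCover σ r X) → HasAllCovers6 m
hasAllCovers6 σ σ-fpf σ-distinct covers =
  graph , regular , λ r 1≤r r≤6 → Product.map₂ exactCover (covers r 1≤r r≤6)
  where open InvolutionGraph σ σ-fpf σ-distinct

Equivariant : ∀ {d m k} → (Fin k → Fin m) → Involutions d k → Involutions d m → Set
Equivariant h τ σ = ∀ i x → h (act τ i x) ≡ act σ i (h x)

module Pullback {d m k : ℕ} (τ : Involutions d k) (σ : Involutions d m) (h : Fin k → Fin m)
                (h-equivariant : Equivariant h τ σ) where

  fixedPointFree : IsFixedPointFree σ → IsFixedPointFree τ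
  fixedPointFree σ-fpf = record { fixedPointFree = λ i x τᵢx≡x →
    IsFixedPointFree.fixedPointFree σ-fpf i (h x) (trans (sym (h-equivariant i x)) (cong h τᵢx≡x)) }

  distinctNeighbours : HasDistinctNeighbours σ → HasDistinctNeighbours τ
  distinctNeighbours σ-distinct = record { distinctNeighbours = λ x {i} {j} τᵢx≡τⱼx →
    HasDistinctNeighbours.distinctNeighbours σ-distinct (h x)
      (trans (sym (h-equivariant i x)) (trans (cong h τᵢx≡τⱼx) (h-equivariant j x))) }

  exactCover : ∀ {r X} → IsExactCover σ r X → IsExactCover τ r (X ∘ h)
  exactCover {X = X} X-cover = record { counts = λ x →
    trans (countFin-cong λ i → cong X (h-equivariant i x)) (IsExactCover.counts X-cover (h x)) }

module Tensor {d m k : ℕ} (σ : Involutions d m) (τ : Involutions d k) where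

  product-act : Fin d → Fin (m * k) → Fin (m * k)
  product-act i = uncurry combine ∘ Product.map (act σ i) (act τ i) ∘ remQuot {m} k

  remQuot-product-act : ∀ i x →
    remQuot {m} k (product-act i x) ≡ Product.map (act σ i) (act τ i) (remQuot {m} k x)
  remQuot-product-act i x =
    uncurry (remQuot-combine {m} {k}) (Product.map (act σ i) (act τ i) (remQuot {m} k x))

  product : Involutions d (m * k)
  act product = product-act
  act-involutive product i x = begin
    product-act i (product-act i x)
      ≡⟨ cong (uncurry combine ∘ Product.map (act σ i) (act τ i)) (remQuot-product-act i x) ⟩
    combine (act σ i (act σ i (proj₁ (remQuot {m} k x)))) (act τ i (act τ i (proj₂ (remQuot {m} k x))))
      ≡⟨ cong₂ combine (act-involutive σ i _) (act-involutive τ i _) ⟩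
    uncurry combine (remQuot {m} k x)
      ≡⟨ combine-remQuot {m} k x ⟩
    x ∎
    where open ≡-Reasoning

  proj₁-equivariant : Equivariant (proj₁ ∘ remQuot {m} k) product σ
  proj₁-equivariant i x = cong proj₁ (remQuot-product-act i x)

  proj₂-equivariant : Equivariant (proj₂ ∘ remQuot {m} k) product τ
  proj₂-equivariant i x = cong proj₂ (remQuot-product-act i x)

infixr 7 _⊗_

_⊗_ : ∀ {d m k} → Involutions d m → Involutions d k → Involutions d (m * k)
_⊗_ = Tensor.product

module _ {d m k : ℕ} {σ : Involutions d m} {τ : Involutions d k} where
  open Tensor σ τ

  ⊗-fixedPointFreeˡ : IsFixedPointFree σ → IsFixedPointFree (σ ⊗ τ)
  ⊗-fixedPointFreeˡ = Pullback.fixedPointFree (σ ⊗ τ) σ _ proj₁-equivariant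

  ⊗-distinctNeighboursʳ : HasDistinctNeighbours τ → HasDistinctNeighbours (σ ⊗ τ)
  ⊗-distinctNeighboursʳ = Pullback.distinctNeighbours (σ ⊗ τ) τ _ proj₂-equivariant

  ⊗-exactCoverˡ : ∀ {r X} → IsExactCover σ r X → IsExactCover (σ ⊗ τ) r (X ∘ proj₁ ∘ remQuot {m} k)
  ⊗-exactCoverˡ = Pullback.exactCover (σ ⊗ τ) σ _ proj₁-equivariant

  ⊗-exactCoverʳ : ∀ {r X} → IsExactCover τ r X → IsExactCover (σ ⊗ τ) r (X ∘ proj₂ ∘ remQuot {m} k)
  ⊗-exactCoverʳ = Pullback.exactCover (σ ⊗ τ) τ _ proj₂-equivariant

isInvolutive? : ∀ {d m} (f : Fin d → Fin m → Fin m) → Dec (∀ i x → f i (f i x) ≡ x)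
isInvolutive? f = all? λ i → all? λ x → f i (f i x) ≟ x

module _ {d : ℕ} (p q : ℕ) .{{_ : NonZero q}} .{{_ : NonZero (p + q)}} where

  -- The points a < p and p + j (j < q) are the two sides of K_{p,q}; the i-th map swaps a with
  -- p + (a + i) mod q, so p + j is matched into the p-side by p of any q consecutive indices, and
  -- leftPart p is an exact (d · p / q)-cover when q ∣ d. The final mod only converts to Fin: the
  -- value is already below p + q.
  star-act : Fin d → Fin (p + q) → Fin (p + q)
  star-act i x = (if a <ᵇ p then p + (a + c) % q else if b <ᵇ p then b else a) mod (p + q)
    where
    a c b : ℕ
    a = toℕ x
    c = toℕ i % q
    b = (a ∸ p + (q ∸ c)) % q

  star : {True (isInvolutive? star-act)} → Involutions d (p + q)
  act star = star-act
  act-involutive (star {involutive}) = toWitness involutive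

leftPart : ∀ p {q} → Fin (p + q) → Bool
leftPart p x = toℕ x <ᵇ p

star₁ : Involutions 6 7
star₁ = star 1 6

star₂ : Involutions 6 4
star₂ = star 1 3

star₃ : Involutions 6 3
star₃ = star 1 2

star₄ : Involutions 6 5
star₄ = star 2 3

star₅ : Involutions 6 11
star₅ = star 5 6

star₆ : Involutions 6 2
star₆ = star 1 1

family : Involutions 6 9240
family = star₆ ⊗ star₁ ⊗ star₂ ⊗ star₃ ⊗ star₄ ⊗ star₅

hasAllCovers6-9240 : HasAllCovers6 9240
hasAllCovers6-9240 = hasAllCovers6 family
  (⊗-fixedPointFreeˡ (from-yes (isFixedPointFree? star₆)))
  (⊗-distinctNeighboursʳ (⊗-distinctNeighboursʳ (⊗-distinctNeighboursʳ (⊗-distinctNeighboursʳ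
    (⊗-distinctNeighboursʳ (from-yes (hasDistinctNeighbours? star₅)))))))
  covers
  where
  covers : ∀ r → 1 ≤ r → r ≤ 6 → ∃[ X ] IsExactCover family r X
  covers 1 _ _ = _ , ⊗-exactCoverʳ (⊗-exactCoverˡ
                       (from-yes (isExactCover? star₁ 1 (leftPart 1))))
  covers 2 _ _ = _ , ⊗-exactCoverʳ (⊗-exactCoverʳ (⊗-exactCoverˡ
                       (from-yes (isExactCover? star₂ 2 (leftPart 1)))))
  covers 3 _ _ = _ , ⊗-exactCoverʳ (⊗-exactCoverʳ (⊗-exactCoverʳ (⊗-exactCoverˡ
                       (from-yes (isExactCover? star₃ 3 (leftPart 1))))))
  covers 4 _ _ = _ , ⊗-exactCoverʳ (⊗-exactCoverʳ (⊗-exactCoverʳ (⊗-exactCoverʳ (⊗-exactCoverˡ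
                       (from-yes (isExactCover? star₄ 4 (leftPart 2)))))))
  covers 5 _ _ = _ , ⊗-exactCoverʳ (⊗-exactCoverʳ (⊗-exactCoverʳ (⊗-exactCoverʳ (⊗-exactCoverʳ
                       (from-yes (isExactCover? star₅ 5 (leftPart 5)))))))
  covers 6 _ _ = _ , ⊗-exactCoverˡ (from-yes (isExactCover? star₆ 6 (leftPart 1)))
  covers (suc (suc (suc (suc (suc (suc (suc _))))))) _ (s≤s (s≤s (s≤s (s≤s (s≤s (s≤s ()))))))

proposition4p4 : HasAllCovers6 9240 × (∀ n → 1 ≤ n → n < 9240 → ¬ HasAllCovers6 n)
proposition4p4 =
  hasAllCovers6-9240 , λ n 1≤n n<9240 covers → <⇒≱ n<9240 (hasAllCovers6⇒9240≤ 1≤n covers)
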